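{- There is no nonprincipal ultrafilter $\mathcal{U}$ on $\mathbb{N}$ such that $\mathcal{U}\leq_{fe}\mathcal{V}$ for every nonprincipal ultrafilter $\mathcal{V}$ on $\mathbb{N}$; i.e., $((\beta\mathbb{N}\setminus\mathbb{N})/\equiv_{fe},\leq_{fe})$ has no minimum.
   Context: $\mathbb{N}=\{0,1,2,\dots\}$; $\beta\mathbb{N}\setminus\mathbb{N}$ denotes the set of nonprincipal ultrafilters on $\mathbb{N}$. For $A,B\subseteq\mathbb{N}$, $A\leq_{fe}B$ means that for every finite $F\subseteq A$ there is $k\in\mathbb{N}$ with $F+k\subseteq B$. For ultrafilters, $\mathcal{U}\leq_{fe}\mathcal{V}$ means that for every $B\in\mathcal{V}$ there is $A\in\mathcal{U}$ with $A\leq_{fe}B$; $\equiv_{fe}$ is the associated equivalence. -}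

module Defs where

open import Level using (0ℓ)
open import Data.Nat using (ℕ; _+_)
open import Data.List using (List)
open import Data.List.Relation.Unary.All using (All)
open import Data.Product using (Σ; ∃; _×_)
open import Data.Sum using (_⊎_)
open import Data.Empty using (⊥)
open import Relation.Nullary using (¬_)
open import Relation.Binary.PropositionalEquality using (_≡_)
open import Relation.Unary using (Pred; _⊆_; _∩_; ∅; U; ∁; _∈_; ｛_｝)

Subset : Set₁
Subset = Pred ℕ 0ℓ

Family : Set₁
Family = Pred Subset 0ℓ

record IsUltrafilter (𝒰 : Family) : Set₁ where
  field
    whole    : 𝒰 U
    noEmpty  : ¬ 𝒰 ∅
    upward   : ∀ {A B : Subset} → A ⊆ B → 𝒰 A → 𝒰 B
    meet     : ∀ {A B : Subset} → 𝒰 A → 𝒰 B → 𝒰 (A ∩ B)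
    ultra    : ∀ (A : Subset) → 𝒰 A ⊎ 𝒰 (∁ A)

IsNonprincipal : Family → Set
IsNonprincipal 𝒰 = ∀ (n : ℕ) → ¬ 𝒰 ｛ n ｝

IsNonprincipalUltrafilter : Family → Set₁
IsNonprincipalUltrafilter 𝒰 = IsUltrafilter 𝒰 × IsNonprincipal 𝒰

-- A ≤fe B : every finite F ⊆ A has a translate F + k ⊆ B.
-- Finite subsets of A are given by lists of elements of A.
_≤fe_ : Subset → Subset → Set
A ≤fe B = ∀ (F : List ℕ) → All A F → ∃ λ (k : ℕ) → All (λ x → B (x + k)) F

_≤feᵘ_ : Family → Family → Set₁
𝒰 ≤feᵘ 𝒱 = ∀ (B : Subset) → 𝒱 B → Σ Subset λ A → 𝒰 A × (A ≤fe B)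

-- Push 𝒰 forward along n ↦ 2^(2n+1) and along n ↦ 2^(2n+2). Both images are
-- nonprincipal ultrafilters, containing the odd and the even powers of 2
-- respectively, so a minimum 𝒰 would contain a set A ≤fe (odd powers) and a set
-- B ≤fe (even powers). Translating {x, y} ⊆ A ∩ B with x < y into either set
-- writes y − x as 2^q − 2^p with q odd, and also with q even. But 2^q − 2^p with
-- p < q lies in [2^(q−1), 2^q), which determines q. So A ∩ B has at most one
-- element, which no member of a nonprincipal ultrafilter can have.
module Submission where

open import Defs
open import Data.List using ([]; _∷_)
open import Data.List.Relation.Unary.All using ([]; _∷_)
open import Data.Nat using (ℕ; suc; _+_; _*_; _∸_; _^_; _≤_; _<_; s≤s)
open import Data.Nat.Properties
open import Data.Product using (Σ; ∃; _×_; _,_)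
open import Data.Sum using (inj₁; inj₂)
open import Function using (_∘_)
open import Function.Definitions using (Injective)
open import Relation.Binary using (tri<; tri≈; tri>)
open import Relation.Binary.PropositionalEquality
open import Relation.Nullary using (¬_; contradiction)
open import Relation.Unary using (Empty; _∩_; _⊢_; ｛_｝)

Subsingleton : Subset → Set
Subsingleton C = ∀ {x y} → C x → C y → x ≡ y

Range : (ℕ → ℕ) → Subset
Range f y = ∃ λ n → y ≡ f n

image : (ℕ → ℕ) → Family → Family
image f 𝒰 B = 𝒰 (f ⊢ B)

module _ {𝒰 : Family} (uf : IsUltrafilter 𝒰) where
  open IsUltrafilter uf

  member⇒¬Empty : ∀ {C} → 𝒰 C → ¬ Empty C
  member⇒¬Empty 𝒰C empty = noEmpty (upward (λ {x} → empty x) 𝒰C)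

  nonprincipal⇒¬subsingleton : IsNonprincipal 𝒰 → ∀ {C} → 𝒰 C → ¬ Subsingleton C
  nonprincipal⇒¬subsingleton nonprincipal {C} 𝒰C single = member⇒¬Empty 𝒰C lonely
    where
    lonely : Empty C
    lonely a a∈C with ultra ｛ a ｝
    ... | inj₁ 𝒰｛a｝ = nonprincipal a 𝒰｛a｝
    ... | inj₂ 𝒰∁｛a｝ = member⇒¬Empty (meet 𝒰C 𝒰∁｛a｝) (λ b (b∈C , a≢b) → a≢b (single a∈C b∈C))

  image-isUltrafilter : ∀ f → IsUltrafilter (image f 𝒰)
  image-isUltrafilter f = record
    { whole   = whole
    ; noEmpty = noEmpty
    ; upward  = λ A⊆B → upward A⊆B
    ; meet    = meet
    ; ultra   = λ A → ultra (f ⊢ A)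
    }

  image-isNonprincipal : IsNonprincipal 𝒰 → ∀ {f} → Injective _≡_ _≡_ f → IsNonprincipal (image f 𝒰)
  image-isNonprincipal nonprincipal f-inj m 𝒰f⁻¹m = member⇒¬Empty 𝒰f⁻¹m λ n m≡fn →
    nonprincipal n (upward (λ m≡fk → f-inj (trans (sym m≡fn) m≡fk)) 𝒰f⁻¹m)

  Range∈image : ∀ f → image f 𝒰 (Range f)
  Range∈image f = upward (λ {n} _ → n , refl) whole

  minimum⇒≤fe-Range : IsNonprincipal 𝒰 → (∀ 𝒱 → IsNonprincipalUltrafilter 𝒱 → 𝒰 ≤feᵘ 𝒱) →
                      ∀ {f} → Injective _≡_ _≡_ f → Σ Subset λ A → 𝒰 A × A ≤fe Range f
  minimum⇒≤fe-Range nonprincipal minimum {f} f-inj =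
    minimum (image f 𝒰) (image-isUltrafilter f , image-isNonprincipal nonprincipal f-inj)
      (Range f) (Range∈image f)

^-cancelˡ-≡ : ∀ m → 1 < m → ∀ {n o} → m ^ n ≡ m ^ o → n ≡ o
^-cancelˡ-≡ m 1<m {n} {o} eq with <-cmp n o
... | tri< n<o _ _ = contradiction eq (<⇒≢ (^-monoʳ-< m 1<m n<o))
... | tri≈ _ n≡o _ = n≡o
... | tri> _ _ n>o = contradiction (sym eq) (<⇒≢ (^-monoʳ-< m 1<m n>o))

FloorLog₂ : ℕ → ℕ → Set
FloorLog₂ d q = 2 ^ q ≤ d × d < 2 ^ suc q

FloorLog₂-unique : ∀ {d q r} → FloorLog₂ d q → FloorLog₂ d r → q ≡ r
FloorLog₂-unique {d} {q} {r} (2^q≤d , d<2^1+q) (2^r≤d , d<2^1+r) with <-cmp q r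
... | tri< q<r _ _ = contradiction (≤-<-trans (≤-trans (^-monoʳ-≤ 2 q<r) 2^r≤d) d<2^1+q) (<-irrefl refl)
... | tri≈ _ q≡r _ = q≡r
... | tri> _ _ q>r = contradiction (≤-<-trans (≤-trans (^-monoʳ-≤ 2 q>r) 2^q≤d) d<2^1+r) (<-irrefl refl)

power-gap-FloorLog₂ : ∀ {p q d} → 0 < d → 2 ^ p + d ≡ 2 ^ suc q → FloorLog₂ d q
power-gap-FloorLog₂ {p} {q} {d} 0<d eq = +-cancelˡ-≤ (2 ^ q) (2 ^ q) d 2^q+2^q≤2^q+d , d<2^1+q
  where
  2^p<2^1+q : 2 ^ p < 2 ^ suc q
  2^p<2^1+q = subst (2 ^ p <_) eq (m<m+n (2 ^ p) 0<d)

  p≤q : p ≤ q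
  p≤q with <-cmp p (suc q)
  ... | tri< (s≤s p≤q) _ _ = p≤q
  ... | tri≈ _ p≡1+q _ = contradiction (cong (2 ^_) p≡1+q) (<⇒≢ 2^p<2^1+q)
  ... | tri> _ _ p>1+q = contradiction (<-trans 2^p<2^1+q (^-monoʳ-< 2 ≤-refl p>1+q)) (<-irrefl refl)

  2^q+2^q≤2^q+d : 2 ^ q + 2 ^ q ≤ 2 ^ q + d
  2^q+2^q≤2^q+d = begin
    2 ^ q + 2 ^ q       ≡⟨ cong (2 ^ q +_) (sym (+-identityʳ (2 ^ q))) ⟩
    2 ^ suc q           ≡⟨ sym eq ⟩
    2 ^ p + d           ≤⟨ +-monoˡ-≤ d (^-monoʳ-≤ 2 p≤q) ⟩
    2 ^ q + d           ∎
    where open ≤-Reasoning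

  d<2^1+q : d < 2 ^ suc q
  d<2^1+q = subst (d <_) eq (m<n+m d (m^n>0 2 p))

translation-gap-FloorLog₂ : ∀ {x y k p q} → x < y → x + k ≡ 2 ^ p → y + k ≡ 2 ^ suc q →
                            FloorLog₂ (y ∸ x) q
translation-gap-FloorLog₂ {x} {y} {k} {p} {q} x<y x+k≡2^p y+k≡2^1+q =
  power-gap-FloorLog₂ {p} {q} (m<n⇒0<n∸m x<y) 2^p+[y∸x]≡2^1+q
  where
  open ≡-Reasoning
  2^p+[y∸x]≡2^1+q : 2 ^ p + (y ∸ x) ≡ 2 ^ suc q
  2^p+[y∸x]≡2^1+q = begin
    2 ^ p + (y ∸ x)     ≡⟨ cong (_+ (y ∸ x)) (sym x+k≡2^p) ⟩
    x + k + (y ∸ x)     ≡⟨ +-assoc x k (y ∸ x) ⟩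
    x + (k + (y ∸ x))   ≡⟨ cong (x +_) (+-comm k (y ∸ x)) ⟩
    x + ((y ∸ x) + k)   ≡⟨ sym (+-assoc x (y ∸ x) k) ⟩
    x + (y ∸ x) + k     ≡⟨ cong (_+ k) (m+[n∸m]≡n (<⇒≤ x<y)) ⟩
    y + k               ≡⟨ y+k≡2^1+q ⟩
    2 ^ suc q           ∎

≤fe-powers⇒FloorLog₂ : ∀ (g : ℕ → ℕ) {A x y} → A ≤fe Range (λ n → 2 ^ suc (g n)) →
                       A x → A y → x < y → ∃ λ n → FloorLog₂ (y ∸ x) (g n)
≤fe-powers⇒FloorLog₂ g A≤powers x∈A y∈A x<y
  with A≤powers (_ ∷ _ ∷ []) (x∈A ∷ y∈A ∷ [])
... | k , ((m , x+k≡2^m) ∷ (n , y+k≡2^n) ∷ []) =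
  n , translation-gap-FloorLog₂ {p = suc (g m)} {q = g n} x<y x+k≡2^m y+k≡2^n

oddPower : ℕ → ℕ
oddPower n = 2 ^ suc (2 * n)

evenPower : ℕ → ℕ
evenPower n = 2 ^ suc (suc (2 * n))

oddPower-injective : Injective _≡_ _≡_ oddPower
oddPower-injective = *-cancelˡ-≡ _ _ 2 ∘ suc-injective ∘ ^-cancelˡ-≡ 2 ≤-refl

evenPower-injective : Injective _≡_ _≡_ evenPower
evenPower-injective = *-cancelˡ-≡ _ _ 2 ∘ suc-injective ∘ suc-injective ∘ ^-cancelˡ-≡ 2 ≤-refl

≤fe-oddPowers-evenPowers⇒¬<-pair : ∀ {A B} → A ≤fe Range oddPower → B ≤fe Range evenPower →
                                    ∀ {x y} → (A ∩ B) x → (A ∩ B) y → ¬ x < y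
≤fe-oddPowers-evenPowers⇒¬<-pair A≤odd B≤even (x∈A , x∈B) (y∈A , y∈B) x<y
  with ≤fe-powers⇒FloorLog₂ (2 *_) A≤odd x∈A y∈A x<y
     | ≤fe-powers⇒FloorLog₂ (suc ∘ (2 *_)) B≤even x∈B y∈B x<y
... | m , log₂-odd | n , log₂-even = even≢odd m n (FloorLog₂-unique log₂-odd log₂-even)

≤fe-oddPowers-evenPowers⇒subsingleton : ∀ {A B} → A ≤fe Range oddPower → B ≤fe Range evenPower →
                                        Subsingleton (A ∩ B)
≤fe-oddPowers-evenPowers⇒subsingleton A≤odd B≤even {x} {y} x∈A∩B y∈A∩B with <-cmp x y
... | tri< x<y _ _ = contradiction x<y (≤fe-oddPowers-evenPowers⇒¬<-pair A≤odd B≤even x∈A∩B y∈A∩B)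
... | tri≈ _ x≡y _ = x≡y
... | tri> _ _ y<x = contradiction y<x (≤fe-oddPowers-evenPowers⇒¬<-pair A≤odd B≤even y∈A∩B x∈A∩B)

corollary15 : ¬ (Σ Family λ 𝒰 → IsNonprincipalUltrafilter 𝒰 × (∀ (𝒱 : Family) → IsNonprincipalUltrafilter 𝒱 → 𝒰 ≤feᵘ 𝒱))
corollary15 (𝒰 , (uf , nonprincipal) , minimum)
  with minimum⇒≤fe-Range uf nonprincipal minimum oddPower-injective
     | minimum⇒≤fe-Range uf nonprincipal minimum evenPower-injective
... | A , 𝒰A , A≤odd | B , 𝒰B , B≤even =
  nonprincipal⇒¬subsingleton uf nonprincipal (IsUltrafilter.meet uf 𝒰A 𝒰B)
    (≤fe-oddPowers-evenPowers⇒subsingleton A≤odd B≤even)
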